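{- Let $F$ be a graph with at least one edge, let $e_1,\dots,e_{e(F)}$ be an enumeration of $E(F)$, and let $(H^1,\sigma_1)$ be an $F$-splittable $F$-coloured graph with $\sigma_1$ surjective onto $V(F)$. For $j\ge 1$ define $(H^{j+1},\sigma_{j+1})=(H^j,\sigma_j)_{e_{j'}}$ where $j'\in\{1,\dots,e(F)\}$ satisfies $j'\equiv j \pmod{e(F)}$. Let $G$ be a graph such that there is no homomorphism from $F$ to $G$. Then for all sufficiently large $m$, there is no homomorphism from $H^m$ to $G$.
   Context: An $F$-coloured graph is a pair $(H,\sigma)$ with $\sigma:V(H)\to V(F)$ a homomorphism. For an $F$-coloured graph $(H,\sigma)$ with $\sigma$ surjective and an edge $e=ab\in E(F)$, $(H,\sigma)_e$ is the $F$-coloured graph formed by two disjoint copies $(H_1,\sigma_1)$, $(H_2,\sigma_2)$ of $(H,\sigma)$, together with all edges between $\sigma_1^{ -1}(a)$ and $\sigma_2^{ -1}(b)$ and all edges between $\sigma_1^{ -1}(b)$ and $\sigma_2^{ -1}(a)$, coloured by $\sigma_1\cup\sigma_2$. A graph $H$ is $F$-splittable with witness $\sigma$ if $\sigma$ is an $F$-colouring of $H$ such that every subgraph $H'$ of $H$ has an edge cut-set whose edges all join two fixed colours $a,b$. -}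

module Defs where

open import Data.Nat using (ℕ; zero; suc; _+_; NonZero)
open import Data.Nat.DivMod using (_mod_)
open import Data.Fin using (Fin; splitAt)
open import Data.Sum using (_⊎_; inj₁; inj₂)
open import Data.Product using (Σ; _×_; _,_; ∃; ∃-syntax)
open import Data.Bool using (Bool; true; false)
open import Relation.Binary.PropositionalEquality using (_≡_)
open import Relation.Nullary using (¬_)

record Graph : Set₁ where
  constructor mkGraph
  field
    n   : ℕ
    Adj : Fin n → Fin n → Set
open Graph public

record Simple (G : Graph) : Set where
  field
    sym     : ∀ u v → Adj G u v → Adj G v u
    irrefl  : ∀ v → ¬ Adj G v v

IsHom : (H G : Graph) → (Fin (n H) → Fin (n G)) → Set
IsHom H G f = ∀ u v → Adj H u v → Adj G (f u) (f v)

Hom : Graph → Graph → Set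
Hom H G = Σ (Fin (n H) → Fin (n G)) (IsHom H G)

-- An F-coloured graph: a graph together with a map to V(F)
-- (that it is a homomorphism is a separate hypothesis, IsHom).
record Coloured (F : Graph) : Set₁ where
  constructor _,c_
  field
    graph : Graph
    col   : Fin (n graph) → Fin (n F)
open Coloured public

Surjective : ∀ {A B : Set} → (A → B) → Set
Surjective {A} {B} f = ∀ (b : B) → ∃[ a ] f a ≡ b

JoinsColours : ∀ {m} → Fin m → Fin m → Fin m → Fin m → Set
JoinsColours a b c d = (c ≡ a × d ≡ b) ⊎ (c ≡ b × d ≡ a)

-- (H,σ)_e for e = ab: two disjoint copies (vertices Fin (n + n), first copy
-- via splitAt = inj₁, second copy = inj₂), plus all edges between
-- σ₁⁻¹(a) and σ₂⁻¹(b) and between σ₁⁻¹(b) and σ₂⁻¹(a) (in both directions,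
-- so the adjacency stays symmetric).
private
  dupAdj : ∀ {F : Graph} (C : Coloured F) → Fin (n F) → Fin (n F) →
           Fin (n (graph C)) ⊎ Fin (n (graph C)) →
           Fin (n (graph C)) ⊎ Fin (n (graph C)) → Set
  dupAdj C a b (inj₁ u) (inj₁ v) = Adj (graph C) u v
  dupAdj C a b (inj₂ u) (inj₂ v) = Adj (graph C) u v
  dupAdj C a b (inj₁ u) (inj₂ v) = JoinsColours a b (col C u) (col C v)
  dupAdj C a b (inj₂ u) (inj₁ v) = JoinsColours a b (col C u) (col C v)

  dupCol : ∀ {F : Graph} (C : Coloured F) →
           Fin (n (graph C)) ⊎ Fin (n (graph C)) → Fin (n F)
  dupCol C (inj₁ u) = col C u
  dupCol C (inj₂ u) = col C u

splitAlong : ∀ {F : Graph} → Coloured F → Fin (n F) × Fin (n F) → Coloured F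
splitAlong {F} C (a , b) =
  mkGraph (n (graph C) + n (graph C))
          (λ x y → dupAdj C a b (splitAt (n (graph C)) x) (splitAt (n (graph C)) y))
  ,c (λ x → dupCol C (splitAt (n (graph C)) x))

-- An enumeration e : Fin k → V(F) × V(F) of E(F) (each edge as an ordered pair,
-- every edge listed exactly once up to orientation); hence k = e(F).
SameEdge : ∀ {m} → Fin m × Fin m → Fin m × Fin m → Set
SameEdge (a , b) (c , d) = JoinsColours a b c d

record EdgeEnumeration (F : Graph) (k : ℕ) (e : Fin k → Fin (n F) × Fin (n F)) : Set where
  field
    isEdge   : ∀ i → let (a , b) = e i in Adj F a b
    covers   : ∀ u v → Adj F u v → ∃[ i ] SameEdge (e i) (u , v)
    distinct : ∀ i j → SameEdge (e i) (e j) → i ≡ j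

-- The sequence: seqH C e i = (H^{i+1}, σ_{i+1}); so (H^{j+1},σ_{j+1}) =
-- (H^j,σ_j)_{e_{j'}} with j' ≡ j (mod k), 1-based j' corresponds to the
-- 0-based index (j-1) mod k.
seqH : ∀ {F : Graph} (k : ℕ) .{{_ : NonZero k}} →
       (Fin k → Fin (n F) × Fin (n F)) → Coloured F → ℕ → Coloured F
seqH k e C zero    = C
seqH k e C (suc i) = splitAlong (seqH k e C i) (e (i mod k))

record Subgraph (H : Graph) : Set₁ where
  field
    W    : Fin (n H) → Set
    E'   : Fin (n H) → Fin (n H) → Set
    sub  : ∀ u v → E' u v → Adj H u v × W u × W v

CutBetween : ∀ {F H : Graph} → (Fin (n H) → Fin (n F)) → Subgraph H →
             Fin (n F) → Fin (n F) → Set₁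
CutBetween {F} {H} σ H' a b =
  Σ (Fin (n H) → Set) λ X →
    (∀ v → X v → Subgraph.W H' v) ×
    (∃[ x ] X x) ×
    (∃[ y ] (Subgraph.W H' y × ¬ X y)) ×
    (∀ u v → Subgraph.E' H' u v → X u → ¬ X v → JoinsColours a b (σ u) (σ v))

Nontrivial : ∀ {H : Graph} → Subgraph H → Set
Nontrivial {H} H' = Σ (Fin (n H)) λ x → Σ (Fin (n H)) λ y →
  Subgraph.W H' x × Subgraph.W H' y × ¬ x ≡ y

Splittable : (F H : Graph) → (Fin (n H) → Fin (n F)) → Set₁
Splittable F H σ =
  IsHom H F σ ×
  (∀ (H' : Subgraph H) → Nontrivial H' →
     Σ (Fin (n F)) λ a → Σ (Fin (n F)) λ b → CutBetween {F} σ H' a b)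

{-# OPTIONS --safe #-}
-- A homomorphism φ : H → G of an F-coloured graph (H, σ) has the profile
-- {(σ v, φ v)} ⊆ V(F) × V(G). Restricting φ from (H, σ)_{ab} to either copy of
-- (H, σ) can only shrink the profile; if neither restriction shrinks it, any
-- two vertices of G lying over a and over b in the profile are adjacent,
-- because the copies are completely joined between colours a and b. A profile
-- has at most |F| |G| elements, so descending from H^m, m ≥ (|F| |G| + 1) e(F),
-- through rounds of e(F) splittings, some round shrinks nothing. That round
-- covers every edge of F, and choosing over each colour (σ is onto) a vertex
-- of G in the profile gives a homomorphism F → G.
module Submission where

open import Defs
open import Data.Nat using (ℕ; zero; suc; _+_; _*_; _∸_; _≤_; _<_; NonZero; s≤s; s≤s⁻¹; _<?_)
open import Data.Nat.Properties using (≤-refl; ≤-trans; <-≤-trans; ≤-<-trans; ≤⇒≯; ≮⇒≥; m<1+n⇒m<n∨m≡n; m∸n+n≡m)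
open import Data.Nat.DivMod using (_mod_; _%_; [m+kn]%n≡m%n; m<n⇒m%n≡m)
open import Data.Fin using (Fin; toℕ; combine; _↑ˡ_; _↑ʳ_)
open import Data.Fin.Properties using (any?; _≟_; combine-injective; splitAt-↑ˡ; splitAt-↑ʳ; toℕ-injective; toℕ-fromℕ<; toℕ<n)
open import Data.Fin.Subset using (Subset; _∈_; _⊆_; ∣_∣)
open import Data.Fin.Subset.Properties using (_∈?_; p⊂q⇒∣p∣<∣q∣; p⊆q⇒∣p∣≤∣q∣; ∣p∣≤n)
open import Data.Vec using (tabulate)
open import Data.Vec.Properties using (lookup∘tabulate; lookup⇒[]=; []=⇒lookup)
open import Data.Bool using (true)
open import Data.Product using (Σ; _×_; ∃-syntax; _,_; proj₁; proj₂)
open import Data.Sum using (_⊎_; inj₁; inj₂)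
open import Function using (_∘_)
open import Relation.Nullary using (¬_; Dec; yes; no; does; contradiction)
open import Relation.Nullary.Decidable using (dec-true)
open import Relation.Binary.PropositionalEquality using (_≡_; refl; sym; trans; cong; subst; subst₂; module ≡-Reasoning)

image : ∀ {m n} → (Fin m → Fin n) → Subset n
image f = tabulate λ y → does (any? λ x → f x ≟ y)

∈-image : ∀ {m n} (f : Fin m → Fin n) x → f x ∈ image f
∈-image f x = lookup⇒[]= (f x) (image f)
  (trans (lookup∘tabulate _ (f x)) (dec-true (any? _) (x , refl)))

∈-image⁻ : ∀ {m n} (f : Fin m → Fin n) {y} → y ∈ image f → ∃[ x ] f x ≡ y
∈-image⁻ f {y} y∈f = witness (any? λ x → f x ≟ y) (trans (sym (lookup∘tabulate _ y)) ([]=⇒lookup y∈f))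
  where
  witness : ∀ {A : Set} (a? : Dec A) → does a? ≡ true → A
  witness (yes a) _ = a
  witness (no _) ()

image-⊆ : ∀ {l m n} {f : Fin l → Fin n} {g : Fin m → Fin n} →
          (∀ x → ∃[ x′ ] f x ≡ g x′) → image f ⊆ image g
image-⊆ {f = f} {g} f-through-g y∈f with ∈-image⁻ f y∈f
... | x , refl with f-through-g x
... | x′ , fx≡gx′ = subst (_∈ image g) (sym fx≡gx′) (∈-image g x′)

p⊆q⇒∣q∣≤∣p∣⇒q⊆p : ∀ {n} {p q : Subset n} → p ⊆ q → ∣ q ∣ ≤ ∣ p ∣ → q ⊆ p
p⊆q⇒∣q∣≤∣p∣⇒q⊆p {p = p} p⊆q ∣q∣≤∣p∣ {x} x∈q with x ∈? p
... | yes x∈p = x∈p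
... | no x∉p = contradiction (p⊂q⇒∣p∣<∣q∣ (p⊆q , x , x∈q , x∉p)) (≤⇒≯ ∣q∣≤∣p∣)

all<suc : ∀ {P : ℕ → Set} {j} → (∀ i → i < j → P i) → P j → ∀ i → i < suc j → P i
all<suc all<j Pj i i<1+j with m<1+n⇒m<n∨m≡n i<1+j
... | inj₁ i<j = all<j i i<j
... | inj₂ refl = Pj

[i+t*k]mod[k]≡i : ∀ {k} .{{_ : NonZero k}} t (i : Fin k) → (toℕ i + t * k) mod k ≡ i
[i+t*k]mod[k]≡i {k} t i = toℕ-injective (begin
  toℕ ((toℕ i + t * k) mod k) ≡⟨ toℕ-fromℕ< _ ⟩
  (toℕ i + t * k) % k         ≡⟨ [m+kn]%n≡m%n (toℕ i) t k ⟩
  toℕ i % k                   ≡⟨ m<n⇒m%n≡m (toℕ<n i) ⟩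
  toℕ i                       ∎)
  where open ≡-Reasoning

-- Subsets of V(F) × V(G) are subsets of Fin (|F| * |G|), pairs encoded by combine.
Covers : (G : Graph) {m : ℕ} → Subset (m * n G) → Fin m × Fin m → Set
Covers G P (a , b) = ∀ x y → combine a x ∈ P → combine b y ∈ P → Adj G x y

module _ {F G : Graph} where

  profile : (C : Coloured F) → Hom (graph C) G → Subset (n F * n G)
  profile C (φ , _) = image λ v → combine (col C v) (φ v)

  ∈-profile⁻ : ∀ (C : Coloured F) (φ : Hom (graph C) G) {c g} → combine c g ∈ profile C φ →
               ∃[ v ] col C v ≡ c × proj₁ φ v ≡ g
  ∈-profile⁻ C (φ , _) {c} {g} cg∈ with ∈-image⁻ _ cg∈
  ... | v , eq = v , combine-injective (col C v) (φ v) c g eq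

  Covers-antitone : ∀ {P Q : Subset (n F * n G)} → P ⊆ Q →
                    ∀ (ab : Fin (n F) × Fin (n F)) → Covers G Q ab → Covers G P ab
  Covers-antitone P⊆Q _ cov x y ax∈P by∈P = cov x y (P⊆Q ax∈P) (P⊆Q by∈P)

  covering-profile⇒Hom : ∀ {k} {e : Fin k → Fin (n F) × Fin (n F)} → EdgeEnumeration F k e →
    Simple G → (C : Coloured F) → Surjective (col C) → (φ : Hom (graph C) G) →
    (∀ i → Covers G (profile C φ) (e i)) → Hom F G
  covering-profile⇒Hom en Gs C surj φ cov = ψ , ψ-hom
    where
    ψ : Fin (n F) → Fin (n G)
    ψ c = proj₁ φ (proj₁ (surj c))
    ∈-profile : ∀ c → combine c (ψ c) ∈ profile C φ
    ∈-profile c = subst (λ d → combine d (ψ c) ∈ profile C φ) (proj₂ (surj c)) (∈-image _ (proj₁ (surj c)))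
    ψ-hom : IsHom F G ψ
    ψ-hom u v uv with EdgeEnumeration.covers en u v uv
    ... | i , inj₁ (refl , refl) = cov i _ _ (∈-profile u) (∈-profile v)
    ... | i , inj₂ (refl , refl) = Simple.sym Gs _ _ (cov i _ _ (∈-profile v) (∈-profile u))

  module _ (C : Coloured F) (ab : Fin (n F) × Fin (n F)) where

    private
      N = n (graph C)
      C₂ = splitAlong C ab

    col-↑ˡ : ∀ u → col C₂ (u ↑ˡ N) ≡ col C u
    col-↑ˡ u rewrite splitAt-↑ˡ N u N = refl

    col-↑ʳ : ∀ u → col C₂ (N ↑ʳ u) ≡ col C u
    col-↑ʳ u rewrite splitAt-↑ʳ N N u = refl

    restrictˡ : Hom (graph C₂) G → Hom (graph C) G
    restrictˡ (φ , φ-hom) = (λ u → φ (u ↑ˡ N)) , λ u v uv → φ-hom _ _ (adj u v uv)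
      where
      adj : ∀ u v → Adj (graph C) u v → Adj (graph C₂) (u ↑ˡ N) (v ↑ˡ N)
      adj u v uv rewrite splitAt-↑ˡ N u N | splitAt-↑ˡ N v N = uv

    restrictʳ : Hom (graph C₂) G → Hom (graph C) G
    restrictʳ (φ , φ-hom) = (λ u → φ (N ↑ʳ u)) , λ u v uv → φ-hom _ _ (adj u v uv)
      where
      adj : ∀ u v → Adj (graph C) u v → Adj (graph C₂) (N ↑ʳ u) (N ↑ʳ v)
      adj u v uv rewrite splitAt-↑ʳ N N u | splitAt-↑ʳ N N v = uv

    profile-restrictˡ-⊆ : ∀ φ → profile C (restrictˡ φ) ⊆ profile C₂ φ
    profile-restrictˡ-⊆ φ = image-⊆ λ u → u ↑ˡ N , cong (λ c → combine c (proj₁ φ (u ↑ˡ N))) (sym (col-↑ˡ u))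

    profile-restrictʳ-⊆ : ∀ φ → profile C (restrictʳ φ) ⊆ profile C₂ φ
    profile-restrictʳ-⊆ φ = image-⊆ λ u → N ↑ʳ u , cong (λ c → combine c (proj₁ φ (N ↑ʳ u))) (sym (col-↑ʳ u))

    profile-kept⇒Covers : ∀ φ → profile C₂ φ ⊆ profile C (restrictˡ φ) →
      profile C₂ φ ⊆ profile C (restrictʳ φ) → Covers G (profile C₂ φ) ab
    profile-kept⇒Covers φ keptˡ keptʳ x y ax∈ by∈
      with ∈-profile⁻ C (restrictˡ φ) (keptˡ ax∈) | ∈-profile⁻ C (restrictʳ φ) (keptʳ by∈)
    ... | u , cu≡a , φu≡x | v , cv≡b , φv≡y =
      subst₂ (Adj G) φu≡x φv≡y (proj₂ φ _ _ (joined u v (inj₁ (cu≡a , cv≡b))))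
      where
      joined : ∀ u v → JoinsColours (proj₁ ab) (proj₂ ab) (col C u) (col C v) →
               Adj (graph C₂) (u ↑ˡ N) (N ↑ʳ v)
      joined u v uv rewrite splitAt-↑ˡ N u N | splitAt-↑ʳ N N v = uv

  module _ {k : ℕ} .{{_ : NonZero k}} (e : Fin k → Fin (n F) × Fin (n F)) (C : Coloured F) where

    -- A record, so that the level l can be inferred from a homomorphism.
    record HomAt (l : ℕ) : Set where
      constructor at
      field hom : Hom (graph (seqH k e C l)) G
    open HomAt

    profileAt : ∀ {l} → HomAt l → Subset (n F * n G)
    profileAt {l} φ = profile (seqH k e C l) (hom φ)

    size : ∀ {l} → HomAt l → ℕ
    size φ = ∣ profileAt φ ∣

    ↓ˡ : ∀ {l} → HomAt (suc l) → HomAt l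
    ↓ˡ {l} (at φ) = at (restrictˡ (seqH k e C l) (e (l mod k)) φ)

    ↓ʳ : ∀ {l} → HomAt (suc l) → HomAt l
    ↓ʳ {l} (at φ) = at (restrictʳ (seqH k e C l) (e (l mod k)) φ)

    size≤∣F∣*∣G∣ : ∀ {l} (φ : HomAt l) → size φ ≤ n F * n G
    size≤∣F∣*∣G∣ φ = ∣p∣≤n (profileAt φ)

    size-↓ˡ : ∀ {l} (φ : HomAt (suc l)) → size (↓ˡ φ) ≤ size φ
    size-↓ˡ {l} (at φ) = p⊆q⇒∣p∣≤∣q∣ (profile-restrictˡ-⊆ (seqH k e C l) (e (l mod k)) φ)

    descend : ∀ j {l} → HomAt (j + l) → HomAt l
    descend zero φ = φ
    descend (suc j) φ = descend j (↓ˡ φ)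

    size-descend : ∀ j {l} (φ : HomAt (j + l)) → size (descend j φ) ≤ size φ
    size-descend zero φ = ≤-refl
    size-descend (suc j) φ = ≤-trans (size-descend j (↓ˡ φ)) (size-↓ˡ φ)

    kept-profile : ∀ {l} (φ : HomAt (suc l)) → ¬ size (↓ˡ φ) < size φ → ¬ size (↓ʳ φ) < size φ →
                   profileAt φ ⊆ profileAt (↓ˡ φ) × Covers G (profileAt φ) (e (l mod k))
    kept-profile {l} (at φ) keptˡ keptʳ = ⊇ˡ , profile-kept⇒Covers Cₗ eₗ φ ⊇ˡ ⊇ʳ
      where
      Cₗ = seqH k e C l
      eₗ = e (l mod k)
      ⊇ˡ = p⊆q⇒∣q∣≤∣p∣⇒q⊆p (profile-restrictˡ-⊆ Cₗ eₗ φ) (≮⇒≥ keptˡ)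
      ⊇ʳ = p⊆q⇒∣q∣≤∣p∣⇒q⊆p (profile-restrictʳ-⊆ Cₗ eₗ φ) (≮⇒≥ keptʳ)

    round-shrinks-or-covers : ∀ t j (φ : HomAt (j + t * k)) →
      (Σ (HomAt (t * k)) λ ψ → size ψ < size φ) ⊎
      (∀ i → i < j → Covers G (profileAt φ) (e ((i + t * k) mod k)))
    round-shrinks-or-covers t zero φ = inj₂ λ _ ()
    round-shrinks-or-covers t (suc j) φ with size (↓ˡ φ) <? size φ | size (↓ʳ φ) <? size φ
    ... | yes shrinks | _ = inj₁ (descend j (↓ˡ φ) , ≤-<-trans (size-descend j (↓ˡ φ)) shrinks)
    ... | no _ | yes shrinks = inj₁ (descend j (↓ʳ φ) , ≤-<-trans (size-descend j (↓ʳ φ)) shrinks)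
    ... | no keptˡ | no keptʳ with kept-profile φ keptˡ keptʳ | round-shrinks-or-covers t j (↓ˡ φ)
    ...   | _ | inj₁ (ψ , shrinks) = inj₁ (ψ , <-≤-trans shrinks (size-↓ˡ φ))
    ...   | φ⊆φˡ , covers | inj₂ coversˡ =
            inj₂ (all<suc {P = λ i → Covers G (profileAt φ) (e ((i + t * k) mod k))}
                          (λ i i<j → Covers-antitone φ⊆φˡ _ (coversˡ i i<j)) covers)

    surjective-seqH : Surjective (col C) → ∀ l → Surjective (col (seqH k e C l))
    surjective-seqH surj zero = surj
    surjective-seqH surj (suc l) c with surjective-seqH surj l c
    ... | v , cv≡c = v ↑ˡ _ , trans (col-↑ˡ (seqH k e C l) (e (l mod k)) v) cv≡c

    small-profile⇒Hom : EdgeEnumeration F k e → Simple G → Surjective (col C) →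
                           ∀ t (φ : HomAt (t * k)) → size φ < t → Hom F G
    small-profile⇒Hom en Gs surj (suc t) φ small with round-shrinks-or-covers t k φ
    ... | inj₁ (ψ , shrinks) = small-profile⇒Hom en Gs surj t ψ (≤-trans shrinks (s≤s⁻¹ small))
    ... | inj₂ covers = covering-profile⇒Hom en Gs _ (surjective-seqH surj (suc t * k)) (hom φ)
          λ i → subst (Covers G (profileAt φ) ∘ e) ([i+t*k]mod[k]≡i t i) (covers (toℕ i) (toℕ<n i))

lemma2p15 : (F : Graph) → Simple F →
    (∃[ u ] ∃[ v ] Adj F u v) →
    (k : ℕ) .{{_ : NonZero k}} → (e : Fin k → Fin (n F) × Fin (n F)) →
    EdgeEnumeration F k e →
    (C : Coloured F) → Simple (graph C) →
    Splittable F (graph C) (col C) → Surjective (col C) →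
    (G : Graph) → Simple G → ¬ Hom F G →
    ∃[ M ] (∀ m → M ≤ m → ¬ Hom (graph (seqH k e C m)) G)
lemma2p15 F _ _ k e en C _ _ surj G Gs ¬F→G = M , λ m M≤m φ → ¬F→G (hom-above m M≤m φ)
  where
  M = suc (n F * n G) * k
  hom-above : ∀ m → M ≤ m → Hom (graph (seqH k e C m)) G → Hom F G
  hom-above m M≤m φ =
    small-profile⇒Hom e C en Gs surj (suc (n F * n G)) φM (s≤s (size≤∣F∣*∣G∣ e C φM))
    where
    φM : HomAt {G = G} e C M
    φM = descend e C (m ∸ M) (subst (HomAt {G = G} e C) (sym (m∸n+n≡m M≤m)) (at φ))
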